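{- Let $\mathcal{M}=(Q,r)$ be a matroid and let $X,Y\subseteq Q$ be flats. There exists a set $Z\subset Q$ satisfying (AK1) $r(Z|X)=0$ and (AK2) $r(X'|Z)=r(X'|Y)$ for every $X'\subseteq X$, if and only if $(X,Y)$ is a modular pair, i.e. $r(X)+r(Y)=r(X\cup Y)+r(X\cap Y)$.
   Context: For $A,B\subseteq Q$ write $AB=A\cup B$ and $r(A|B)=r(AB)-r(B)$. A flat of $\mathcal{M}$ is a set $F\subseteq Q$ with $r(Fx)>r(F)$ for every $x\in Q\setminus F$. -}

module Defs where

open import Data.Nat using (ℕ; _+_; _∸_; _≤_; _<_)
open import Data.Fin using (Fin)
open import Data.Fin.Subset using (Subset; _∪_; _∩_; _⊆_; _∈_; ∣_∣; ⁅_⁆)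
open import Data.Product using (_×_)
open import Relation.Binary.PropositionalEquality using (_≡_)
open import Relation.Nullary using (¬_)

record Matroid (n : ℕ) : Set where
  field
    r         : Subset n → ℕ
    r-bounded : ∀ A → r A ≤ ∣ A ∣
    r-mono    : ∀ A B → A ⊆ B → r A ≤ r B
    r-submod  : ∀ A B → r (A ∪ B) + r (A ∩ B) ≤ r A + r B

module _ {n : ℕ} (M : Matroid n) where
  open Matroid M

  -- r(A|B) = r(AB) - r(B)   (nonnegative by monotonicity, so ∸ is exact)
  condRank : Subset n → Subset n → ℕ
  condRank A B = r (A ∪ B) ∸ r B

  IsFlat : Subset n → Set
  IsFlat F = ∀ x → ¬ (x ∈ F) → r F < r (F ∪ ⁅ x ⁆)

  ModularPair : Subset n → Subset n → Set
  ModularPair X Y = r X + r Y ≡ r (X ∪ Y) + r (X ∩ Y)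

  AK : Subset n → Subset n → Subset n → Set
  AK X Y Z = (condRank Z X ≡ 0)
           × (∀ X' → X' ⊆ X → condRank X' Z ≡ condRank X' Y)

{-# OPTIONS --safe #-}
module Submission where

-- If (X,Y) is modular, Z = X ∩ Y works: modularity passes to every W with
-- X ∩ Y ⊆ W ⊆ X, and for W = X' ∪ (X ∩ Y) this is exactly (AK2) at X'.
-- Conversely, (AK1) and (AK2) at X' = Z put Z inside both flats, (AK2) at
-- X' = X ∩ Y gives r(Z) = r(X ∩ Y), and then (AK2) at X' = X is the
-- modularity equation.

open import Defs
open import Data.Nat using (ℕ; _+_; _∸_; _≤_)
open import Data.Nat.Properties
  using (+-comm; +-assoc; +-mono-≤; +-monoˡ-≤; +-cancelˡ-≤; +-commutativeSemigroup;
         ≤-trans; ≤-antisym; <-≤-trans; <⇒≱; m∸n+n≡m; m≤n⇒m∸n≡0; m∸n≡0⇒m≤n;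
         [m+n]∸[m+o]≡n∸o; module ≤-Reasoning)
open import Algebra.Properties.CommutativeSemigroup +-commutativeSemigroup
  using (xy∙z≈xz∙y; xy∙z≈x∙zy)
open import Data.Fin.Subset using (Subset; _∪_; _∩_; _⊆_; _∈_; ⁅_⁆)
open import Data.Fin.Subset.Properties
  using (_∈?_; x∈⁅y⁆⇒x≡y; x∈p∪q⁻; x∈p∩q⁺; p⊆p∪q; q⊆p∪q; p∩q⊆p; p∩q⊆q;
         ⊆-refl; ⊆-trans; ⊆-antisym; ∪-assoc)
open import Data.Product using (Σ; _,_)
open import Data.Sum using ([_,_]′)
open import Relation.Nullary using (yes; no; contradiction)
open import Relation.Binary.PropositionalEquality
open import Function.Bundles using (_⇔_; mk⇔; module Equivalence)

private
  variable
    n : ℕ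
    A B C X Y Z F : Subset n

+≡+⇒∸≡∸ : ∀ {a b c d} → a + d ≡ c + b → a ∸ b ≡ c ∸ d
+≡+⇒∸≡∸ {a} {b} {c} {d} a+d≡c+b = begin
  a ∸ b             ≡⟨ sym ([m+n]∸[m+o]≡n∸o d a b) ⟩
  (d + a) ∸ (d + b) ≡⟨ cong₂ _∸_ (trans (+-comm d a) a+d≡c+b) (+-comm d b) ⟩
  (c + b) ∸ (b + d) ≡⟨ cong (_∸ (b + d)) (+-comm c b) ⟩
  (b + c) ∸ (b + d) ≡⟨ [m+n]∸[m+o]≡n∸o b c d ⟩
  c ∸ d             ∎
  where open ≡-Reasoning

∸≡∸⇒+≡+ : ∀ {a b c d} → b ≤ a → d ≤ c → a ∸ b ≡ c ∸ d → a + d ≡ c + b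
∸≡∸⇒+≡+ {a} {b} {c} {d} b≤a d≤c a∸b≡c∸d = begin
  a + d           ≡⟨ cong (_+ d) (sym (m∸n+n≡m b≤a)) ⟩
  a ∸ b + b + d   ≡⟨ cong (λ t → t + b + d) a∸b≡c∸d ⟩
  c ∸ d + b + d   ≡⟨ xy∙z≈xz∙y (c ∸ d) b d ⟩
  c ∸ d + d + b   ≡⟨ cong (_+ b) (m∸n+n≡m d≤c) ⟩
  c + b           ∎
  where open ≡-Reasoning

∪-lub : A ⊆ C → B ⊆ C → A ∪ B ⊆ C
∪-lub {A = A} {B = B} A⊆C B⊆C x∈A∪B = [ A⊆C , B⊆C ]′ (x∈p∪q⁻ A B x∈A∪B)

∩-glb : C ⊆ A → C ⊆ B → C ⊆ A ∩ B
∩-glb C⊆A C⊆B x∈C = x∈p∩q⁺ (C⊆A x∈C , C⊆B x∈C)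

⊆⇒∪≡ : B ⊆ A → A ∪ B ≡ A
⊆⇒∪≡ {B = B} B⊆A = ⊆-antisym (∪-lub ⊆-refl B⊆A) (p⊆p∪q B)

∩-between : ∀ {W} → X ∩ Y ⊆ W → W ⊆ X → W ∩ Y ≡ X ∩ Y
∩-between {X = X} {Y = Y} {W = W} X∩Y⊆W W⊆X =
  ⊆-antisym (∩-glb (⊆-trans (p∩q⊆p W Y) W⊆X) (p∩q⊆q W Y))
            (∩-glb X∩Y⊆W (p∩q⊆q X Y))

module _ (M : Matroid n) where
  open Matroid M

  ⊆⇒condRank≡0 : A ⊆ B → condRank M A B ≡ 0
  ⊆⇒condRank≡0 {A = A} {B = B} A⊆B = m≤n⇒m∸n≡0 (r-mono (A ∪ B) B (∪-lub A⊆B ⊆-refl))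

  condRank≡0⇒r≤ : condRank M A B ≡ 0 → r A ≤ r B
  condRank≡0⇒r≤ {A = A} {B = B} A|B≡0 =
    ≤-trans (r-mono A (A ∪ B) (p⊆p∪q B)) (m∸n≡0⇒m≤n A|B≡0)

  condRank-⊇ : B ⊆ A → condRank M A B ≡ r A ∸ r B
  condRank-⊇ {B = B} B⊆A = cong (λ S → r S ∸ r B) (⊆⇒∪≡ B⊆A)

  condRank-∪-absorb : C ⊆ B → condRank M (A ∪ C) B ≡ condRank M A B
  condRank-∪-absorb {C = C} {B = B} {A = A} C⊆B = cong (λ S → r S ∸ r B) (begin
    (A ∪ C) ∪ B ≡⟨ ∪-assoc A C B ⟩
    A ∪ (C ∪ B) ≡⟨ cong (A ∪_) (⊆-antisym (∪-lub C⊆B ⊆-refl) (q⊆p∪q C B)) ⟩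
    A ∪ B       ∎)
    where open ≡-Reasoning

  -- A point outside the flat F would raise r(A ∪ F) above r(F).
  flat-condRank≡0⇒⊆ : IsFlat M F → condRank M A F ≡ 0 → A ⊆ F
  flat-condRank≡0⇒⊆ {F = F} {A = A} F-flat A|F≡0 {x} x∈A with x ∈? F
  ... | yes x∈F = x∈F
  ... | no  x∉F = contradiction (m∸n≡0⇒m≤n A|F≡0) (<⇒≱ (<-≤-trans (F-flat x x∉F) Fx≤AF))
    where
    ⁅x⁆⊆A : ⁅ x ⁆ ⊆ A
    ⁅x⁆⊆A y∈⁅x⁆ = subst (_∈ A) (sym (x∈⁅y⁆⇒x≡y x y∈⁅x⁆)) x∈A

    Fx≤AF : r (F ∪ ⁅ x ⁆) ≤ r (A ∪ F)
    Fx≤AF = r-mono (F ∪ ⁅ x ⁆) (A ∪ F)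
              (∪-lub (q⊆p∪q A F) (⊆-trans ⁅x⁆⊆A (p⊆p∪q F)))

  modularPair⇔condRank : ModularPair M X Y ⇔ condRank M X (X ∩ Y) ≡ condRank M X Y
  modularPair⇔condRank {X = X} {Y = Y} = mk⇔
    (λ mod → trans (condRank-⊇ (p∩q⊆p X Y)) (+≡+⇒∸≡∸ {r X} {r (X ∩ Y)} {r (X ∪ Y)} {r Y} mod))
    (λ eq → ∸≡∸⇒+≡+ (r-mono (X ∩ Y) X (p∩q⊆p X Y)) (r-mono Y (X ∪ Y) (q⊆p∪q X Y))
               (trans (sym (condRank-⊇ (p∩q⊆p X Y))) eq))

  modularPair-between : ∀ {W} → X ∩ Y ⊆ W → W ⊆ X → ModularPair M X Y → ModularPair M W Y
  modularPair-between {X = X} {Y = Y} {W = W} X∩Y⊆W W⊆X mod =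
    ≤-antisym (+-cancelˡ-≤ (r (X ∪ Y)) _ _ shifted) (r-submod W Y)
    where
    open ≤-Reasoning

    submod-X-WY : r (X ∪ Y) + r W ≤ r X + r (W ∪ Y)
    submod-X-WY = begin
      r (X ∪ Y) + r W
        ≤⟨ +-mono-≤ (r-mono (X ∪ Y) (X ∪ (W ∪ Y))
                       (∪-lub (p⊆p∪q (W ∪ Y)) (⊆-trans (q⊆p∪q W Y) (q⊆p∪q X (W ∪ Y)))))
                    (r-mono W (X ∩ (W ∪ Y)) (∩-glb W⊆X (p⊆p∪q Y))) ⟩
      r (X ∪ (W ∪ Y)) + r (X ∩ (W ∪ Y))
        ≤⟨ r-submod X (W ∪ Y) ⟩
      r X + r (W ∪ Y) ∎

    shifted : r (X ∪ Y) + (r W + r Y) ≤ r (X ∪ Y) + (r (W ∪ Y) + r (W ∩ Y))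
    shifted = begin
      r (X ∪ Y) + (r W + r Y)       ≡⟨ sym (+-assoc (r (X ∪ Y)) (r W) (r Y)) ⟩
      r (X ∪ Y) + r W + r Y         ≤⟨ +-monoˡ-≤ (r Y) submod-X-WY ⟩
      r X + r (W ∪ Y) + r Y         ≡⟨ xy∙z≈xz∙y (r X) (r (W ∪ Y)) (r Y) ⟩
      r X + r Y + r (W ∪ Y)         ≡⟨ cong (_+ r (W ∪ Y)) mod ⟩
      r (X ∪ Y) + r (X ∩ Y) + r (W ∪ Y)
        ≡⟨ xy∙z≈x∙zy (r (X ∪ Y)) (r (X ∩ Y)) (r (W ∪ Y)) ⟩
      r (X ∪ Y) + (r (W ∪ Y) + r (X ∩ Y))
        ≡⟨ cong (λ S → r (X ∪ Y) + (r (W ∪ Y) + r S)) (sym (∩-between X∩Y⊆W W⊆X)) ⟩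
      r (X ∪ Y) + (r (W ∪ Y) + r (W ∩ Y)) ∎

  modularPair⇒AK : ModularPair M X Y → AK M X Y (X ∩ Y)
  modularPair⇒AK {X = X} {Y = Y} mod = ⊆⇒condRank≡0 (p∩q⊆p X Y) , ak2
    where
    ak2 : ∀ X' → X' ⊆ X → condRank M X' (X ∩ Y) ≡ condRank M X' Y
    ak2 X' X'⊆X = begin
      condRank M X' (X ∩ Y) ≡⟨ sym (condRank-∪-absorb ⊆-refl) ⟩
      condRank M W (X ∩ Y)  ≡⟨ cong (condRank M W) (sym W∩Y≡X∩Y) ⟩
      condRank M W (W ∩ Y)  ≡⟨ Equivalence.to modularPair⇔condRank
                                 (modularPair-between (q⊆p∪q X' (X ∩ Y)) W⊆X mod) ⟩
      condRank M W Y        ≡⟨ condRank-∪-absorb (p∩q⊆q X Y) ⟩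
      condRank M X' Y       ∎
      where
      open ≡-Reasoning
      W : Subset _
      W = X' ∪ (X ∩ Y)
      W⊆X : W ⊆ X
      W⊆X = ∪-lub X'⊆X (p∩q⊆p X Y)
      W∩Y≡X∩Y : W ∩ Y ≡ X ∩ Y
      W∩Y≡X∩Y = ∩-between (q⊆p∪q X' (X ∩ Y)) W⊆X

  AK⇒modularPair : IsFlat M X → IsFlat M Y → AK M X Y Z → ModularPair M X Y
  AK⇒modularPair {X = X} {Y = Y} {Z = Z} X-flat Y-flat (ak1 , ak2) =
    Equivalence.from modularPair⇔condRank (begin
      condRank M X (X ∩ Y) ≡⟨ condRank-⊇ (p∩q⊆p X Y) ⟩
      r X ∸ r (X ∩ Y)      ≡⟨ cong (r X ∸_) (sym rZ≡rX∩Y) ⟩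
      r X ∸ r Z            ≡⟨ sym (condRank-⊇ Z⊆X) ⟩
      condRank M X Z       ≡⟨ ak2 X ⊆-refl ⟩
      condRank M X Y       ∎)
    where
    open ≡-Reasoning
    Z⊆X : Z ⊆ X
    Z⊆X = flat-condRank≡0⇒⊆ X-flat ak1
    Z⊆Y : Z ⊆ Y
    Z⊆Y = flat-condRank≡0⇒⊆ Y-flat (trans (sym (ak2 Z Z⊆X)) (⊆⇒condRank≡0 ⊆-refl))
    rZ≡rX∩Y : r Z ≡ r (X ∩ Y)
    rZ≡rX∩Y = ≤-antisym (r-mono Z (X ∩ Y) (∩-glb Z⊆X Z⊆Y))
      (condRank≡0⇒r≤ (trans (ak2 (X ∩ Y) (p∩q⊆p X Y)) (⊆⇒condRank≡0 (p∩q⊆q X Y))))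

lemma3p8 : ∀ {n} (M : Matroid n) (X Y : Subset n) →
           IsFlat M X → IsFlat M Y →
           (Σ (Subset n) (λ Z → AK M X Y Z)) ⇔ ModularPair M X Y
lemma3p8 M X Y X-flat Y-flat = mk⇔
  (λ (Z , ak) → AK⇒modularPair M X-flat Y-flat ak)
  (λ mod → X ∩ Y , modularPair⇒AK M mod)
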